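{- Consider any play of Morpion Solitaire 5D consisting of $N \ge 3$ legal moves, and let $C_{N-2}, C_{N-1}, C_N$ be the crosses placed in moves $N-2$, $N-1$, $N$ respectively. Then on the board after move $N$, \[ p(C_N)+p(C_{N-1})+p(C_{N-2}) \ge 7, \] where $p(C)$ denotes the potential of a cross $C$.
   Context: Morpion Solitaire 5D is a one-player game on the integer lattice $\mathbb{Z}^2$. Initially there are 36 crosses, placed on the lattice points lying on the boundary of the 12-sided polygon (a "Greek cross") with consecutive vertices $(3,0),(6,0),(6,3),(9,3),(9,6),(6,6),(6,9),(3,9),(3,6),(0,6),(0,3),(3,3)$; each of its 12 edges contains exactly 4 lattice points. A move consists of: (1) placing a new cross on a lattice point that currently has no cross; (2) drawing a line, i.e. a segment covering exactly 5 consecutive lattice points in one of the four directions (horizontal, vertical, or one of the two diagonals $(1,1)$, $(1,-1)$), such that all 5 covered points carry crosses and one of them is the cross placed in step (1). In the 5D variant, a newly drawn line may not share any lattice point with a previously drawn line of the same direction. A line covers the 5 lattice points (and crosses) it passes through. The potential of a cross $C$ on a board is $p(C) = 4 - (\text{number of drawn lines covering } C)$. -}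

module Defs where

open import Data.Integer using (ℤ; +_; -[1+_]; _+_; _*_; _-_)
import Data.Integer.Properties as ℤP
open import Data.Nat using (ℕ)
open import Data.Product using (_×_; _,_; proj₁; proj₂)
open import Data.Product.Properties using (≡-dec)
open import Data.Sum using (_⊎_)
open import Data.List using (List; []; _∷_; _++_; map; concatMap; length; filter; zip)
open import Data.List.Membership.Propositional using (_∈_)
open import Data.List.Relation.Unary.Any using (any?)
open import Relation.Nullary using (¬_; Dec)
open import Relation.Binary.PropositionalEquality using (_≡_)

Point : Set
Point = ℤ × ℤ

_≟ₚ_ : (p q : Point) → Dec (p ≡ q)
_≟ₚ_ = ≡-dec ℤP._≟_ ℤP._≟_

_+ₚ_ : Point → Point → Point
(a , b) +ₚ (c , d) = (a + c , b + d)

_·ₚ_ : ℤ → Point → Point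
k ·ₚ (a , b) = (k * a , k * b)

data Dir : Set where
  horiz vert diag anti : Dir

dirVec : Dir → Point
dirVec horiz = (+ 1 , + 0)
dirVec vert  = (+ 0 , + 1)
dirVec diag  = (+ 1 , + 1)
dirVec anti  = (+ 1 , -[1+ 0 ])

record Line : Set where
  constructor mkLine
  field
    start : Point
    dir   : Dir
open Line public

linePoints : Line → List Point
linePoints l = map (λ k → start l +ₚ ((+ k) ·ₚ dirVec (dir l))) (0 ∷ 1 ∷ 2 ∷ 3 ∷ 4 ∷ [])

Covers : Line → Point → Set
Covers l q = q ∈ linePoints l

-- Initial position: lattice points on the boundary of the Greek-cross polygon.
gcVertices : List Point
gcVertices =
  (+ 3 , + 0) ∷ (+ 6 , + 0) ∷ (+ 6 , + 3) ∷ (+ 9 , + 3) ∷ (+ 9 , + 6) ∷ (+ 6 , + 6) ∷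
  (+ 6 , + 9) ∷ (+ 3 , + 9) ∷ (+ 3 , + 6) ∷ (+ 0 , + 6) ∷ (+ 0 , + 3) ∷ (+ 3 , + 3) ∷ []

gcEdges : List (Point × Point)
gcEdges = zip gcVertices (rest gcVertices)
  where
  rest : List Point → List Point
  rest []       = []
  rest (x ∷ xs) = xs ++ (x ∷ [])

-- each edge has length 3 and is axis-parallel; its 4 lattice points are
-- v + (k/3)(w - v) for k = 0,1,2,3, i.e. v + k·(w - v)/3.  Since (w - v) has
-- coordinates in {0, ±3}, we list v + k·u with u the unit step, k = 0..3.
edgePoints : Point × Point → List Point
edgePoints ((a , b) , (c , d)) =
  map (λ k → (a , b) +ₚ ((+ k) ·ₚ (step (c - a) , step (d - b)))) (0 ∷ 1 ∷ 2 ∷ 3 ∷ [])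
  where
  step : ℤ → ℤ
  step (+ 0)     = + 0
  step (+ _)     = + 1
  step -[1+ _ ]  = -[1+ 0 ]

initialCrosses : List Point
initialCrosses = concatMap edgePoints gcEdges

record Move : Set where
  constructor mkMove
  field
    placed : Point
    line   : Line
open Move public

HasCross : List Move → Point → Set
HasCross ms q = q ∈ initialCrosses ⊎ q ∈ map placed ms

drawnLines : List Move → List Line
drawnLines ms = map line ms

-- legality of move m after the (chronological) sequence ms, 5D variant
LegalMove : List Move → Move → Set
LegalMove ms m =
  ¬ HasCross ms (placed m) ×
  Covers (line m) (placed m) ×
  (∀ q → Covers (line m) q → HasCross ms q ⊎ q ≡ placed m) ×
  (∀ l → l ∈ drawnLines ms → dir l ≡ dir (line m) →
     ∀ q → Covers l q → ¬ Covers (line m) q)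

data Play : List Move → Set where
  play-[] : Play []
  play-∷ʳ : ∀ {ms m} → Play ms → LegalMove ms m → Play (ms ++ (m ∷ []))

coverCount : List Line → Point → ℕ
coverCount ls q = length (filter (λ l → any? (q ≟ₚ_) (linePoints l)) ls)

potential : List Move → Point → ℤ
potential ms q = + 4 - + coverCount (drawnLines ms) q

module Submission where

-- Let C₁, C₂, C₃ be the crosses placed by the last three moves, with lines
-- l₁, l₂, l₃.  A freshly placed cross is covered by no earlier line, since every
-- point of a drawn line already carries a cross.  Hence after the last move C₃
-- is covered by l₃ alone, C₂ by l₂ and possibly l₃, and C₁ by l₁ and possibly
-- l₂ and l₃: at most 3 + 3 coverings.  Six coverings would need l₂ and l₃ both
-- through C₁ and l₃ through C₂.  If l₂ and l₃ have the same direction this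
-- violates the 5D rule at C₁; otherwise two lines of different directions meet
-- in at most one point, so C₁ = C₂, although C₂ was placed on an empty point
-- after C₁.  So there are at most 5 coverings, and the potentials sum to ≥ 12 - 5.

open import Defs
open import Data.Integer using (ℤ; +_; -[1+_]; _+_; _*_; _-_; _≤_; +≤+; NonZero)
open import Data.Integer.Properties as ℤP using (*-cancelˡ-≡; neg-mono-≤; pos-+)
open import Data.Integer.Tactic.RingSolver using (solve-∀)
open import Data.List using (List; []; _∷_; _++_; [_]; map; filter; length)
open import Data.List.Properties using (map-++; ++-assoc; ∷ʳ-injective; filter-accept; filter-reject; filter-++; length-++; length-filter)
open import Data.List.Membership.Propositional using (_∈_)
open import Data.List.Membership.Propositional.Properties using (∈-map⁺; ∈-map⁻; ∈-++⁺ˡ; ∈-++⁺ʳ; ∈-++⁻)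
open import Data.List.Relation.Unary.Any using (here; there; any?)
open import Data.Nat as ℕ using (ℕ; suc)
import Data.Nat.Properties as ℕP
open import Data.Product using (_×_; _,_; ∃; proj₁)
open import Data.Sum using (_⊎_; inj₁; inj₂)
open import Relation.Nullary using (¬_; Dec; yes; no)
open import Relation.Binary.PropositionalEquality using (_≡_; refl; sym; trans; cong; cong₂; subst; module ≡-Reasoning)

infix 7 _∙_

_∙_ : Point → Point → ℤ
(a , b) ∙ (c , d) = a * c + b * d

det : Point → Point → ℤ
det (a , b) (c , d) = a * d - b * c

normal : Dir → Point
normal horiz = (+ 0 , + 1)
normal vert  = (+ 1 , + 0)
normal diag  = (+ 1 , -[1+ 0 ])
normal anti  = (+ 1 , + 1)

normal-⊥ : ∀ d → normal d ∙ dirVec d ≡ + 0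
normal-⊥ horiz = refl
normal-⊥ vert  = refl
normal-⊥ diag  = refl
normal-⊥ anti  = refl

∙-shift : ∀ n p k v → n ∙ (p +ₚ (k ·ₚ v)) ≡ n ∙ p + k * (n ∙ v)
∙-shift (n₁ , n₂) (p₁ , p₂) k (v₁ , v₂) = shift n₁ n₂ p₁ p₂ k v₁ v₂
  where
  shift : ∀ n₁ n₂ p₁ p₂ k v₁ v₂ →
          n₁ * (p₁ + k * v₁) + n₂ * (p₂ + k * v₂)
            ≡ (n₁ * p₁ + n₂ * p₂) + k * (n₁ * v₁ + n₂ * v₂)
  shift = solve-∀

line-offset : ∀ l {q} → Covers l q → ∃ λ k → q ≡ start l +ₚ ((+ k) ·ₚ dirVec (dir l))
line-offset l q∈l with ∈-map⁻ (λ k → start l +ₚ ((+ k) ·ₚ dirVec (dir l))) {xs = 0 ∷ 1 ∷ 2 ∷ 3 ∷ 4 ∷ []} q∈l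
... | k , _ , q≡ = k , q≡

on-line-level : ∀ l q → Covers l q → normal (dir l) ∙ q ≡ normal (dir l) ∙ start l
on-line-level l q q∈l with line-offset l q∈l
... | k , q≡ = begin
  n ∙ q                                ≡⟨ cong (n ∙_) q≡ ⟩
  n ∙ (s +ₚ ((+ k) ·ₚ v))              ≡⟨ ∙-shift n s (+ k) v ⟩
  n ∙ s + + k * (n ∙ v)                ≡⟨ cong (λ t → n ∙ s + + k * t) (normal-⊥ (dir l)) ⟩
  n ∙ s + + k * + 0                    ≡⟨ cong (λ t → n ∙ s + t) (ℤP.*-zeroʳ (+ k)) ⟩
  n ∙ s + + 0                          ≡⟨ ℤP.+-identityʳ (n ∙ s) ⟩
  n ∙ s                                ∎
  where
  open ≡-Reasoning
  n = normal (dir l)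
  s = start l
  v = dirVec (dir l)

cramer-x : ∀ n₁ n₂ m₁ m₂ x y →
  (n₁ * m₂ - n₂ * m₁) * x ≡ m₂ * (n₁ * x + n₂ * y) - n₂ * (m₁ * x + m₂ * y)
cramer-x = solve-∀

cramer-y : ∀ n₁ n₂ m₁ m₂ x y →
  (n₁ * m₂ - n₂ * m₁) * y ≡ n₁ * (m₁ * x + m₂ * y) - m₁ * (n₁ * x + n₂ * y)
cramer-y = solve-∀

independent-forms-separate : ∀ n m a b .{{_ : NonZero (det n m)}} →
  n ∙ a ≡ n ∙ b → m ∙ a ≡ m ∙ b → a ≡ b
independent-forms-separate (n₁ , n₂) (m₁ , m₂) (x , y) (x′ , y′) nₑ mₑ =
  cong₂ _,_
    (*-cancelˡ-≡ δ x x′ (trans (cramer-x n₁ n₂ m₁ m₂ x y)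
      (trans (cong₂ (λ u v → m₂ * u - n₂ * v) nₑ mₑ) (sym (cramer-x n₁ n₂ m₁ m₂ x′ y′)))))
    (*-cancelˡ-≡ δ y y′ (trans (cramer-y n₁ n₂ m₁ m₂ x y)
      (trans (cong₂ (λ u v → n₁ * v - m₁ * u) nₑ mₑ) (sym (cramer-y n₁ n₂ m₁ m₂ x′ y′)))))
  where
  δ = n₁ * m₂ - n₂ * m₁

same-or-independent : ∀ d e → d ≡ e ⊎ NonZero (det (normal d) (normal e))
same-or-independent horiz horiz = inj₁ refl
same-or-independent vert  vert  = inj₁ refl
same-or-independent diag  diag  = inj₁ refl
same-or-independent anti  anti  = inj₁ refl
same-or-independent horiz vert  = inj₂ _
same-or-independent horiz diag  = inj₂ _
same-or-independent horiz anti  = inj₂ _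
same-or-independent vert  horiz = inj₂ _
same-or-independent vert  diag  = inj₂ _
same-or-independent vert  anti  = inj₂ _
same-or-independent diag  horiz = inj₂ _
same-or-independent diag  vert  = inj₂ _
same-or-independent diag  anti  = inj₂ _
same-or-independent anti  horiz = inj₂ _
same-or-independent anti  vert  = inj₂ _
same-or-independent anti  diag  = inj₂ _

lines-meet-once : ∀ l l′ {a b} .{{_ : NonZero (det (normal (dir l)) (normal (dir l′)))}} →
  Covers l a → Covers l b → Covers l′ a → Covers l′ b → a ≡ b
lines-meet-once l l′ {a} {b} a∈l b∈l a∈l′ b∈l′ =
  independent-forms-separate (normal (dir l)) (normal (dir l′)) a b
    (trans (on-line-level l a a∈l) (sym (on-line-level l b b∈l)))
    (trans (on-line-level l′ a a∈l′) (sym (on-line-level l′ b b∈l′)))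

cross-persists : ∀ ms ys {q} → HasCross ms q → HasCross (ms ++ ys) q
cross-persists ms ys (inj₁ q∈init) = inj₁ q∈init
cross-persists ms ys (inj₂ q∈ms)   = inj₂ (subst (_ ∈_) (sym (map-++ placed ms ys)) (∈-++⁺ˡ q∈ms))

cross-after-move : ∀ ms m {q} → HasCross ms q ⊎ q ≡ placed m → HasCross (ms ++ [ m ]) q
cross-after-move ms m (inj₁ old)  = cross-persists ms [ m ] old
cross-after-move ms m (inj₂ refl) =
  inj₂ (subst (_ ∈_) (sym (map-++ placed ms [ m ])) (∈-++⁺ʳ (map placed ms) (here refl)))

play-last : ∀ {bs} xs m → bs ≡ xs ++ [ m ] → Play bs → Play xs × LegalMove xs m
play-last [] m () play-[]
play-last (_ ∷ _) m () play-[]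
play-last xs m eq (play-∷ʳ {ms} p legal) with ∷ʳ-injective ms xs eq
... | refl , refl = p , legal

play-split : ∀ {bs} xs m ys → bs ≡ xs ++ m ∷ ys → Play bs → Play xs × LegalMove xs m
play-split xs m []       eq p = play-last xs m eq p
play-split xs m (y ∷ ys) eq p =
  play-last xs m refl (proj₁ (play-split (xs ++ [ m ]) y ys (trans eq (sym (++-assoc xs [ m ] (y ∷ ys)))) p))

lines-on-crosses : ∀ {ms} → Play ms → ∀ {l q} → l ∈ drawnLines ms → Covers l q → HasCross ms q
lines-on-crosses (play-∷ʳ {ms} {m} p (_ , _ , on-crosses , _)) {l} {q} l∈ q∈l
  with ∈-++⁻ (drawnLines ms) (subst (l ∈_) (map-++ line ms [ m ]) l∈)
... | inj₁ l∈ms        = cross-persists ms [ m ] (lines-on-crosses p l∈ms q∈l)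
... | inj₂ (here refl) = cross-after-move ms m (on-crosses q q∈l)

covers? : ∀ q l → Dec (Covers l q)
covers? q l = any? (q ≟ₚ_) (linePoints l)

count-hit : ∀ l ls {q} → Covers l q → coverCount (l ∷ ls) q ≡ suc (coverCount ls q)
count-hit l ls {q} q∈l = cong length (filter-accept (covers? q) q∈l)

count-skip : ∀ l ls {q} → ¬ Covers l q → coverCount (l ∷ ls) q ≡ coverCount ls q
count-skip l ls {q} q∉l = cong length (filter-reject (covers? q) q∉l)

count≤length : ∀ ls q → coverCount ls q ℕ.≤ length ls
count≤length ls q = length-filter (covers? q) ls

count-++ : ∀ ls ls′ q → coverCount (ls ++ ls′) q ≡ coverCount ls q ℕ.+ coverCount ls′ q
count-++ ls ls′ q = trans (cong length (filter-++ (covers? q) ls ls′)) (length-++ (filter (covers? q) ls))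

count-none : ∀ ls q → (∀ {l} → l ∈ ls → ¬ Covers l q) → coverCount ls q ≡ 0
count-none []       q none = refl
count-none (l ∷ ls) q none =
  trans (count-skip l ls (none (here refl))) (count-none ls q (λ l∈ → none (there l∈)))

count-empty-point : ∀ {ms q} → Play ms → ¬ HasCross ms q → coverCount (drawnLines ms) q ≡ 0
count-empty-point p empty = count-none _ _ (λ l∈ q∈l → empty (lines-on-crosses p l∈ q∈l))

count-placed : ∀ {bs} xs m ys → bs ≡ xs ++ m ∷ ys → Play bs →
  coverCount (drawnLines bs) (placed m) ≡ suc (coverCount (drawnLines ys) (placed m))
count-placed {bs} xs m ys eq p with play-split xs m ys eq p
... | pxs , fresh , through , _ = begin
  coverCount (drawnLines bs) q
    ≡⟨ cong (λ b → coverCount (map line b) q) eq ⟩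
  coverCount (drawnLines (xs ++ m ∷ ys)) q
    ≡⟨ cong (λ ls → coverCount ls q) (map-++ line xs (m ∷ ys)) ⟩
  coverCount (drawnLines xs ++ line m ∷ drawnLines ys) q
    ≡⟨ count-++ (drawnLines xs) (line m ∷ drawnLines ys) q ⟩
  coverCount (drawnLines xs) q ℕ.+ coverCount (line m ∷ drawnLines ys) q
    ≡⟨ cong₂ ℕ._+_ (count-empty-point pxs fresh) (count-hit (line m) (drawnLines ys) through) ⟩
  suc (coverCount (drawnLines ys) q)
    ∎
  where
  open ≡-Reasoning
  q = placed m

-- If q already carries a cross before two consecutive moves m, m′, then the line of
-- m′ cannot pass through both q and the cross of m while the line of m passes
-- through q: parallel lines would overlap at q, non-parallel ones would force
-- q = placed m.
no-triple-cover : ∀ {bs} xs m m′ ys q → bs ≡ xs ++ m ∷ m′ ∷ ys → Play bs → HasCross xs q →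
  ¬ (Covers (line m′) (placed m) × Covers (line m) q × Covers (line m′) q)
no-triple-cover xs m m′ ys q eq p q-old (m∈l′ , q∈l , q∈l′)
  with play-split xs m (m′ ∷ ys) eq p
     | play-split (xs ++ [ m ]) m′ ys (trans eq (sym (++-assoc xs [ m ] (m′ ∷ ys)))) p
     | same-or-independent (dir (line m)) (dir (line m′))
... | _ | _ , _ , _ , _ , parallel-disjoint′ | inj₁ parallel =
  parallel-disjoint′ (line m) (∈-map⁺ line (∈-++⁺ʳ xs (here refl))) parallel q q∈l q∈l′
... | _ , fresh , through , _ | _ | inj₂ independent =
  fresh (subst (HasCross xs) (lines-meet-once (line m) (line m′) {{independent}} q∈l through q∈l′ m∈l′) q-old)

extra-coverings : ∀ l₂ l₃ p₁ p₂ → ¬ (Covers l₃ p₂ × Covers l₂ p₁ × Covers l₃ p₁) →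
  coverCount (l₃ ∷ []) p₂ ℕ.+ coverCount (l₂ ∷ l₃ ∷ []) p₁ ℕ.≤ 2
extra-coverings l₂ l₃ p₁ p₂ not-all with covers? p₂ l₃
... | no p₂∉l₃  = begin
  coverCount (l₃ ∷ []) p₂ ℕ.+ b ≡⟨ cong (ℕ._+ b) (count-skip l₃ [] p₂∉l₃) ⟩
  b                             ≤⟨ count≤length (l₂ ∷ l₃ ∷ []) p₁ ⟩
  2                             ∎
  where
  open ℕP.≤-Reasoning
  b = coverCount (l₂ ∷ l₃ ∷ []) p₁
... | yes p₂∈l₃ = ℕP.+-mono-≤ (count≤length (l₃ ∷ []) p₂) (p₁-once (covers? p₁ l₂))
  where
  p₁-once : Dec (Covers l₂ p₁) → coverCount (l₂ ∷ l₃ ∷ []) p₁ ℕ.≤ 1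
  p₁-once (no p₁∉l₂)  = ℕP.≤-trans (ℕP.≤-reflexive (count-skip l₂ (l₃ ∷ []) p₁∉l₂)) (count≤length (l₃ ∷ []) p₁)
  p₁-once (yes p₁∈l₂) = ℕP.≤-reflexive (trans (count-hit l₂ (l₃ ∷ []) p₁∈l₂)
    (cong suc (count-skip l₃ [] (λ p₁∈l₃ → not-all (p₂∈l₃ , p₁∈l₂ , p₁∈l₃)))))

potential-bound : ∀ x y z → x ℕ.+ y ℕ.+ z ℕ.≤ 5 →
  + 7 ≤ (+ 4 - + x) + (+ 4 - + y) + (+ 4 - + z)
potential-bound x y z total = begin
  + 12 - + 5                                    ≤⟨ ℤP.+-monoʳ-≤ (+ 12) (neg-mono-≤ (+≤+ total)) ⟩
  + 12 - + (x ℕ.+ y ℕ.+ z)                      ≡⟨ cong (λ s → + 12 - s) (sum-pos x y z) ⟩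
  + 12 - (+ x + + y + + z)                      ≡⟨ regroup (+ x) (+ y) (+ z) ⟩
  (+ 4 - + x) + (+ 4 - + y) + (+ 4 - + z)       ∎
  where
  open ℤP.≤-Reasoning
  sum-pos : ∀ x y z → + (x ℕ.+ y ℕ.+ z) ≡ + x + + y + + z
  sum-pos x y z = trans (pos-+ (x ℕ.+ y) z) (cong (λ s → s + + z) (pos-+ x y))
  regroup : ∀ i j k → + 12 - (i + j + k) ≡ (+ 4 - i) + (+ 4 - j) + (+ 4 - k)
  regroup = solve-∀

lemma1 : ∀ (ms : List Move) (m₁ m₂ m₃ : Move) →
    Play (ms ++ m₁ ∷ m₂ ∷ m₃ ∷ []) →
    + 7 ≤ potential (ms ++ m₁ ∷ m₂ ∷ m₃ ∷ []) (placed m₃)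
        + potential (ms ++ m₁ ∷ m₂ ∷ m₃ ∷ []) (placed m₂)
        + potential (ms ++ m₁ ∷ m₂ ∷ m₃ ∷ []) (placed m₁)
lemma1 ms m₁ m₂ m₃ p = potential-bound (count (placed m₃)) (count (placed m₂)) (count (placed m₁)) total
  where
  open ℕP.≤-Reasoning
  count : Point → ℕ
  count = coverCount (drawnLines (ms ++ m₁ ∷ m₂ ∷ m₃ ∷ []))
  a = coverCount (line m₃ ∷ []) (placed m₂)
  b = coverCount (line m₂ ∷ line m₃ ∷ []) (placed m₁)
  count₃ : count (placed m₃) ≡ 1
  count₃ = count-placed (ms ++ m₁ ∷ m₂ ∷ []) m₃ [] (sym (++-assoc ms (m₁ ∷ m₂ ∷ []) [ m₃ ])) p
  count₂ : count (placed m₂) ≡ suc a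
  count₂ = count-placed (ms ++ [ m₁ ]) m₂ [ m₃ ] (sym (++-assoc ms [ m₁ ] (m₂ ∷ m₃ ∷ []))) p
  count₁ : count (placed m₁) ≡ suc b
  count₁ = count-placed ms m₁ (m₂ ∷ m₃ ∷ []) refl p
  not-all : ¬ (Covers (line m₃) (placed m₂) × Covers (line m₂) (placed m₁) × Covers (line m₃) (placed m₁))
  not-all = no-triple-cover (ms ++ [ m₁ ]) m₂ m₃ [] (placed m₁) (sym (++-assoc ms [ m₁ ] (m₂ ∷ m₃ ∷ []))) p
              (cross-after-move ms m₁ (inj₂ refl))
  total : count (placed m₃) ℕ.+ count (placed m₂) ℕ.+ count (placed m₁) ℕ.≤ 5
  total = begin
    count (placed m₃) ℕ.+ count (placed m₂) ℕ.+ count (placed m₁) ≡⟨ cong₂ ℕ._+_ (cong₂ ℕ._+_ count₃ count₂) count₁ ⟩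
    1 ℕ.+ suc a ℕ.+ suc b                                         ≡⟨ cong (2 ℕ.+_) (ℕP.+-suc a b) ⟩
    3 ℕ.+ (a ℕ.+ b)                                               ≤⟨ ℕP.+-monoʳ-≤ 3 (extra-coverings (line m₂) (line m₃) (placed m₁) (placed m₂) not-all) ⟩
    5                                                             ∎
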